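{- Let $n\ge 2$ and let $\tau$ be a permutation of $\{1,\dots,n-1\}$ with $\tau\neq 12\cdots(n-1)$. Run the greedy algorithm described in the context starting from $\Pi'_{n,0}=\tau$ instead of $12\cdots(n-1)$, let $W$ be its output, and let $C$ be the word obtained from $W$ by deleting its last $n-1$ letters and taking the reduced form. Then $C$, regarded as a cyclic word, is not a universal cycle for $n$-permutations (i.e. it is not the case that every permutation of $\{1,\dots,n\}$ is the reduced form of exactly one cyclic factor of length $n$ of $C$).
   Context: For a word $w$ of distinct integers, $\mathrm{red}(w)$ denotes the word obtained by replacing the $i$-th smallest entry of $w$ by $i$. A factor of a word is a block of consecutive letters; in a cyclic word $c_1\cdots c_N$, the cyclic factors of length $n$ are $c_j\cdots c_{j+n-1}$ for $1\le j\le N$, indices modulo $N$. Extensions: for a word $\pi=\pi_1\cdots\pi_m$ of distinct integers and $1\le i\le m$, the $i$-th extension of $\pi$ is $c_b(\pi_1)\cdots c_b(\pi_m)\,b$, where $b$ is the $i$-th smallest element of $\{\pi_1,\dots,\pi_m\}$ and $c_b(x)=x$ if $x<b$, $c_b(x)=x+1$ if $x\ge b$. The $(m+1)$-st extension of $\pi$ is $\pi b$ with $b=\max_j\pi_j+1$. Greedy algorithm from a start word $\Pi'_{n,0}$ (a permutation of $\{1,\dots,n-1\}$): given $\Pi'_{n,k}=a_1a_2\cdots a_{k+n-1}$ (a permutation of $\{1,\dots,k+n-1\}$ in which no two factors of length $n$ have the same reduced form), let $i\in\{1,\dots,n\}$ be minimal such that the $i$-th extension of $a_{k+1}\cdots a_{k+n-1}$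 has reduced form different from the reduced form of every length-$n$ factor of $\Pi'_{n,k}$, let $b$ be the last element of this extension, and set $\Pi'_{n,k+1}=c_b(a_1)\cdots c_b(a_{k+n-1})\,b$. If no such $i$ exists, the algorithm terminates and outputs $\Pi'_{n,k}$. -}

module Defs where

open import Data.Nat using (ℕ; zero; suc; _+_; _∸_; _≤_; _<_; _<ᵇ_; _⊔_)
open import Data.Nat.Properties using (_≟_; _<?_; _≤?_)
open import Data.Bool using (if_then_else_)
open import Data.List using (List; []; _∷_; _++_; map; filter; length; take; drop; upTo; concat; replicate; foldr)
open import Data.List.Properties using (≡-dec)
open import Data.List.Membership.Propositional using (_∈_)
open import Data.List.Relation.Binary.Permutation.Propositional using (_↭_)
open import Data.Product using (Σ; _×_; _,_)
open import Relation.Nullary using (¬_; yes; no)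
open import Relation.Binary.PropositionalEquality using (_≡_)
open import Relation.Binary.Construct.Closure.ReflexiveTransitive using (Star)

Word : Set
Word = List ℕ

rank : Word → ℕ → ℕ
rank s x = length (filter (λ y → y <? x) s)

-- red(w): replace the i-th smallest entry by i (for words of distinct integers)
red : Word → Word
red w = map (λ x → suc (rank w x)) w

_≟w_ : (u v : Word) → Relation.Nullary.Dec (u ≡ v)
_≟w_ = ≡-dec _≟_

headOr : ℕ → Word → ℕ
headOr d []      = d
headOr _ (x ∷ _) = x

maxW : Word → ℕ
maxW = foldr _⊔_ 0

-- the i-th smallest element of s (i ≥ 1), for s of distinct integers
ithSmallest : Word → ℕ → ℕ
ithSmallest s i = headOr 0 (filter (λ x → rank s x ≟ (i ∸ 1)) s)

cb : ℕ → ℕ → ℕ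
cb b x = if x <ᵇ b then x else suc x

-- the last letter b of the i-th extension of s (1 ≤ i ≤ length s + 1)
extB : Word → ℕ → ℕ
extB s i with i ≤? length s
... | yes _ = ithSmallest s i
... | no  _ = suc (maxW s)

ext : Word → ℕ → Word
ext s i = map (cb (extB s i)) s ++ (extB s i ∷ [])

factors : ℕ → Word → List Word
factors n [] = []
factors n (x ∷ xs) with n ≤? length (x ∷ xs)
... | yes _ = take n (x ∷ xs) ∷ factors n xs
... | no  _ = []

patterns : ℕ → Word → List Word
patterns n W = map red (factors n W)

lastPart : ℕ → Word → Word
lastPart n W = drop (length W ∸ (n ∸ 1)) W

initPart : ℕ → Word → Word
initPart n W = take (length W ∸ (n ∸ 1)) W

NewExt : ℕ → Word → ℕ → Set
NewExt n W i = ¬ (red (ext (lastPart n W) i) ∈ patterns n W)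

GreedyStep : ℕ → Word → Word → Set
GreedyStep n W W' =
  Σ ℕ λ i → (1 ≤ i) × (i ≤ n) × NewExt n W i
    × ((j : ℕ) → 1 ≤ j → j < i → ¬ NewExt n W j)
    × (W' ≡ map (cb (extB (lastPart n W) i)) W ++ (extB (lastPart n W) i ∷ []))

GreedyStops : ℕ → Word → Set
GreedyStops n W = (i : ℕ) → 1 ≤ i → i ≤ n → ¬ NewExt n W i

GreedyOutput : ℕ → Word → Word → Set
GreedyOutput n τ W = Star (GreedyStep n) τ W × GreedyStops n W

iota1 : ℕ → Word
iota1 m = map suc (upTo m)

IsPermOf : ℕ → Word → Set
IsPermOf m p = p ↭ iota1 m

-- the cyclic factor of length n of C starting at position j (0-based, j < length C)
cycFactor : ℕ → Word → ℕ → Word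
cycFactor n C j = take n (drop j (concat (replicate (suc n) C)))

occurrences : ℕ → Word → Word → ℕ
occurrences n C p = length (filter (λ j → red (cycFactor n C j) ≟w p) (upTo (length C)))

IsUCycle : ℕ → Word → Set
IsUCycle n C = (p : Word) → IsPermOf n p → occurrences n C p ≡ 1

-- Write m = n - 1 and call a word increasing when its reduced form is 12⋯m. Each length-n factor
-- of the current word starts at one length-m window and ends at the next; the windows run from τ,
-- which is not increasing, to the last window s. So the patterns ending increasing outnumber those
-- starting increasing by exactly [s increasing].
-- If a greedy step produced 12⋯n, then s would be increasing and the step would use the (m+1)-st
-- extension; by minimality the first m extensions, whose patterns start increasing and are pairwise
-- distinct (their last letters are 1, …, m), already occur, so at least m+1 patterns end increasing.
-- But a permutation of {1,…,n} whose last m letters increase is determined by its first letter, so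
-- besides 12⋯n there are only m of them. Hence the patterns of the output are distinct and avoid
-- 12⋯n, and C, which has one cyclic position per factor of the output, is too short to contain
-- every permutation.

module Submission where

open import Defs
open import Data.Bool using (true; false; T)
open import Data.Unit using (tt)
open import Data.List using (List; []; _∷_; _++_; _∷ʳ_; map; filter; length; take; drop; upTo; applyUpTo)
open import Data.List.Properties
  using (length-map; length-++; length-take; length-drop; length-upTo; length-filter; map-id; map-∘; map-++; map-cong;
         map-cong-local; map-upTo; upTo-∷ʳ; take-map; drop-map; take-all; filter-accept; filter-reject; filter-++;
         ∷ʳ-injectiveʳ)
open import Data.List.Membership.Propositional using (_∈_; _∉_)
open import Data.List.Membership.Propositional.Properties
  using (∈-map⁻; ∈-map⁺; ∈-upTo⁻; ∈-upTo⁺; ∈-∃++; ∈-++⁻; ∈-++⁺ˡ; ∈-++⁺ʳ; ∈-filter⁺; ∈-filter⁻)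
open import Data.List.Membership.DecPropositional _≟w_ using (_∈?_)
open import Data.List.Relation.Binary.Subset.Propositional using (_⊆_)
open import Data.List.Relation.Binary.Subset.Propositional.Properties using (⊆-refl)
open import Data.List.Relation.Binary.Permutation.Propositional
  using (_↭_; ↭-refl; ↭-sym; ↭-reflexive; ↭⇒↭ₛ; prep; swap; module PermutationReasoning)
import Data.List.Relation.Binary.Permutation.Propositional.Properties as ↭
open import Data.List.Relation.Binary.Permutation.Propositional.Properties using (↭-length; Any-resp-↭; filter-↭)
open import Data.List.Relation.Unary.Any using (here; there)
open import Data.List.Relation.Unary.All using (All; []; _∷_; tabulate)
import Data.List.Relation.Unary.All as All
import Data.List.Relation.Unary.All.Properties as All
open import Data.List.Relation.Unary.AllPairs using ([]; _∷_)
open import Data.List.Relation.Unary.Unique.Propositional using (Unique)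
import Data.List.Relation.Unary.Unique.Propositional.Properties as Unique
open import Data.Nat using (ℕ; zero; suc; _+_; _∸_; _⊓_; _≤_; _<_; _<ᵇ_; z≤n; s≤s)
open import Data.Nat.Properties
open import Data.Product using (∃; _×_; _,_; proj₂)
open import Data.Sum using (_⊎_; inj₁; inj₂)
open import Function using (_∘_)
open import Relation.Binary.Construct.Closure.ReflexiveTransitive using (Star; ε; _◅_)
open import Relation.Binary.Core using (_Preserves_⟶_)
open import Relation.Binary.Definitions using (tri<; tri≈; tri>)
open import Relation.Binary.PropositionalEquality
open import Data.List.Relation.Binary.Permutation.Setoid.Properties (setoid ℕ) using (Unique-resp-↭)
open import Relation.Nullary using (¬_; yes; no; contradiction)
open import Relation.Nullary.Decidable using (decidable-stable)
open import Relation.Unary using (Decidable)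

take-⊆ : ∀ k (w : Word) → take k w ⊆ w
take-⊆ (suc k) (x ∷ w) (here x≡y) = here x≡y
take-⊆ (suc k) (x ∷ w) (there y∈w) = there (take-⊆ k w y∈w)

drop-⊆ : ∀ k (w : Word) → drop k w ⊆ w
drop-⊆ zero w = λ y∈w → y∈w
drop-⊆ (suc k) [] = λ ()
drop-⊆ (suc k) (x ∷ w) = there ∘ drop-⊆ k w

length-∷ʳ : ∀ (xs : Word) b → length (xs ∷ʳ b) ≡ suc (length xs)
length-∷ʳ xs b = trans (length-++ xs) (+-comm (length xs) 1)

take-∷ʳ : ∀ {k} (xs : Word) b → k ≤ length xs → take k (xs ∷ʳ b) ≡ take k xs
take-∷ʳ {zero} xs b _ = refl
take-∷ʳ {suc k} (x ∷ xs) b (s≤s k≤) = cong (x ∷_) (take-∷ʳ xs b k≤)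

drop-suc-∷ʳ : ∀ {k} (xs : Word) b → k ≤ length xs → drop (suc k) (xs ∷ʳ b) ≡ drop 1 (drop k xs ∷ʳ b)
drop-suc-∷ʳ {zero} xs b _ = refl
drop-suc-∷ʳ {suc k} (x ∷ xs) b (s≤s k≤) = drop-suc-∷ʳ xs b k≤

headOr-∈ : ∀ {d x} {xs : Word} → x ∈ xs → headOr d xs ∈ xs
headOr-∈ {xs = _ ∷ _} _ = here refl

unique-⊆⇒length≤ : ∀ {A : Set} {xs ys : List A} → Unique xs → xs ⊆ ys → length xs ≤ length ys
unique-⊆⇒length≤ {xs = []} _ _ = z≤n
unique-⊆⇒length≤ {xs = x ∷ xs} {ys} (x∉xs ∷ xs-unique) x∷xs⊆ys with ∈-∃++ (x∷xs⊆ys (here refl))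
... | us , vs , refl = begin
  suc (length xs)            ≤⟨ s≤s (unique-⊆⇒length≤ xs-unique xs⊆us++vs) ⟩
  suc (length (us ++ vs))    ≡⟨ cong suc (length-++ us) ⟩
  suc (length us + length vs) ≡⟨ +-suc (length us) (length vs) ⟨
  length us + length (x ∷ vs) ≡⟨ length-++ us ⟨
  length (us ++ x ∷ vs)       ∎
  where
  open ≤-Reasoning
  xs⊆us++vs : xs ⊆ us ++ vs
  xs⊆us++vs {z} z∈xs with ∈-++⁻ us (x∷xs⊆ys (there z∈xs))
  ... | inj₁ z∈us = ∈-++⁺ˡ z∈us
  ... | inj₂ (here refl) = contradiction refl (All.lookup x∉xs z∈xs)
  ... | inj₂ (there z∈vs) = ∈-++⁺ʳ us z∈vs

map-injectiveOn-unique : ∀ {A B : Set} {f : A → B} {xs} → Unique xs →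
  (∀ {x y} → x ∈ xs → y ∈ xs → f x ≡ f y → x ≡ y) → Unique (map f xs)
map-injectiveOn-unique [] _ = []
map-injectiveOn-unique (x∉xs ∷ xs-unique) injective =
  All.map⁺ (All.tabulate λ y∈xs fx≡fy → All.lookup x∉xs y∈xs (injective (here refl) (there y∈xs) fx≡fy))
  ∷ map-injectiveOn-unique xs-unique λ x∈ y∈ → injective (there x∈) (there y∈)

count : ∀ {A : Set} {P : A → Set} → Decidable P → List A → ℕ
count P? = length ∘ filter P?

count-∷ʳ : ∀ {A : Set} {P : A → Set} (P? : Decidable P) xs x → count P? (xs ∷ʳ x) ≡ count P? xs + count P? (x ∷ [])
count-∷ʳ P? xs x = trans (cong length (filter-++ P? xs (x ∷ []))) (length-++ (filter P? xs))

count-[-]-cong : ∀ {A B : Set} {P : A → Set} {Q : B → Set} (P? : Decidable P) (Q? : Decidable Q) {x y} →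
                 (P x → Q y) → (Q y → P x) → count P? (x ∷ []) ≡ count Q? (y ∷ [])
count-[-]-cong P? Q? {x} {y} P⇒Q Q⇒P with P? x | Q? y
... | yes _ | yes _ = refl
... | no _ | no _ = refl
... | yes px | no ¬qy = contradiction (P⇒Q px) ¬qy
... | no ¬px | yes qy = contradiction (Q⇒P qy) ¬px

-- Ranks and reduced forms

rank-∷-< : ∀ {x y} t → x < y → rank (x ∷ t) y ≡ suc (rank t y)
rank-∷-< {y = y} t = cong length ∘ filter-accept (_<? y) {xs = t}

rank-∷-≮ : ∀ {x y} t → ¬ x < y → rank (x ∷ t) y ≡ rank t y
rank-∷-≮ {y = y} t = cong length ∘ filter-reject (_<? y) {xs = t}

rank-≤-length : ∀ t x → rank t x ≤ length t
rank-≤-length t x = length-filter (_<? x) t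

rank-++ : ∀ s t y → rank (s ++ t) y ≡ rank s y + rank t y
rank-++ s t y = trans (cong length (filter-++ (_<? y) s t)) (length-++ (filter (_<? y) s))

rank-↭ : ∀ {s t} → s ↭ t → ∀ y → rank s y ≡ rank t y
rank-↭ s↭t y = ↭-length (filter-↭ (_<? y) s↭t)

rank-mono-≤ : ∀ t {x y} → x ≤ y → rank t x ≤ rank t y
rank-mono-≤ [] _ = z≤n
rank-mono-≤ (z ∷ t) {x} {y} x≤y with z <? x | z <? y
... | yes z<x | yes z<y rewrite rank-∷-< t z<x | rank-∷-< t z<y = s≤s (rank-mono-≤ t x≤y)
... | yes z<x | no z≮y = contradiction (<-≤-trans z<x x≤y) z≮y
... | no z≮x | yes z<y rewrite rank-∷-≮ t z≮x | rank-∷-< t z<y = m≤n⇒m≤1+n (rank-mono-≤ t x≤y)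
... | no z≮x | no z≮y rewrite rank-∷-≮ t z≮x | rank-∷-≮ t z≮y = rank-mono-≤ t x≤y

rank-mono-< : ∀ t {x y} → x ∈ t → x < y → rank t x < rank t y
rank-mono-< (z ∷ t) {x} {y} (here refl) x<y
  rewrite rank-∷-≮ t (<-irrefl {x} refl) | rank-∷-< t x<y = s≤s (rank-mono-≤ t (<⇒≤ x<y))
rank-mono-< (z ∷ t) {x} {y} (there x∈t) x<y with z <? x | z <? y
... | yes z<x | yes z<y rewrite rank-∷-< t z<x | rank-∷-< t z<y = s≤s (rank-mono-< t x∈t x<y)
... | yes z<x | no z≮y = contradiction (<-trans z<x x<y) z≮y
... | no z≮x | yes z<y rewrite rank-∷-≮ t z≮x | rank-∷-< t z<y = m≤n⇒m≤1+n (rank-mono-< t x∈t x<y)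
... | no z≮x | no z≮y rewrite rank-∷-≮ t z≮x | rank-∷-≮ t z≮y = rank-mono-< t x∈t x<y

StrictlyMonotoneOn : Word → (ℕ → ℕ) → Set
StrictlyMonotoneOn u g = ∀ {x y} → x ∈ u → y ∈ u → x < y → g x < g y

monotoneOn-reflects-< : ∀ {u g} → StrictlyMonotoneOn u g →
                        ∀ {x y} → x ∈ u → y ∈ u → g x < g y → x < y
monotoneOn-reflects-< mono {x} {y} x∈u y∈u gx<gy with <-cmp x y
... | tri< x<y _ _ = x<y
... | tri≈ _ refl _ = contradiction gx<gy (<-irrefl refl)
... | tri> _ _ y<x = contradiction (mono y∈u x∈u y<x) (<-asym gx<gy)

monotone⇒monotoneOn : ∀ {g} u → g Preserves _<_ ⟶ _<_ → StrictlyMonotoneOn u g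
monotone⇒monotoneOn u g-mono _ _ = g-mono

rank-map : ∀ {u g} → StrictlyMonotoneOn u g → ∀ {y} → y ∈ u →
           ∀ v → v ⊆ u → rank (map g v) (g y) ≡ rank v y
rank-map mono y∈u [] _ = refl
rank-map {g = g} mono {y} y∈u (z ∷ v) v⊆u with z <? y
... | yes z<y rewrite rank-∷-< (map g v) (mono (v⊆u (here refl)) y∈u z<y) | rank-∷-< v z<y
  = cong suc (rank-map mono y∈u v (v⊆u ∘ there))
... | no z≮y rewrite rank-∷-≮ (map g v) (z≮y ∘ monotoneOn-reflects-< mono (v⊆u (here refl)) y∈u)
                   | rank-∷-≮ v z≮y
  = rank-map mono y∈u v (v⊆u ∘ there)

red-map-monotone : ∀ {u g} → StrictlyMonotoneOn u g → red (map g u) ≡ red u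
red-map-monotone {u} {g} mono = begin
  red (map g u)                              ≡⟨ map-∘ u ⟨
  map (λ y → suc (rank (map g u) (g y))) u   ≡⟨ map-cong-local (tabulate λ y∈u → cong suc (rank-map mono y∈u u ⊆-refl)) ⟩
  red u                                      ∎
  where open ≡-Reasoning

rank-monotoneOn : ∀ e {u} → u ⊆ e → StrictlyMonotoneOn u (suc ∘ rank e)
rank-monotoneOn e u⊆e x∈u _ x<y = s≤s (rank-mono-< e (u⊆e x∈u) x<y)

red-take-red : ∀ k w → red (take k (red w)) ≡ red (take k w)
red-take-red k w = trans (cong red (take-map k w)) (red-map-monotone (rank-monotoneOn w (take-⊆ k w)))

red-drop-red : ∀ k w → red (drop k (red w)) ≡ red (drop k w)
red-drop-red k w = trans (cong red (drop-map k w)) (red-map-monotone (rank-monotoneOn w (drop-⊆ k w)))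

-- The shifts c_b

cb-< : ∀ {b x} → x < b → cb b x ≡ x
cb-< {b} {x} x<b with x <ᵇ b | <⇒<ᵇ x<b
... | true | _ = refl

cb-≥ : ∀ {b x} → b ≤ x → cb b x ≡ suc x
cb-≥ {b} {x} b≤x with x <ᵇ b in x<ᵇb
... | false = refl
... | true = contradiction (<ᵇ⇒< x b (subst T (sym x<ᵇb) tt)) (≤⇒≯ b≤x)

cb-cases : ∀ b x → (x < b × cb b x ≡ x) ⊎ (b ≤ x × cb b x ≡ suc x)
cb-cases b x with x <? b
... | yes x<b = inj₁ (x<b , cb-< x<b)
... | no x≮b = inj₂ (≮⇒≥ x≮b , cb-≥ (≮⇒≥ x≮b))

cb-mono-< : ∀ b → cb b Preserves _<_ ⟶ _<_
cb-mono-< b {x} {y} x<y with cb-cases b x | cb-cases b y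
... | inj₁ (_ , cbx) | inj₁ (_ , cby) rewrite cbx | cby = x<y
... | inj₁ (_ , cbx) | inj₂ (_ , cby) rewrite cbx | cby = m<n⇒m<1+n x<y
... | inj₂ (b≤x , _) | inj₁ (y<b , _) = contradiction (≤-<-trans b≤x x<y) (<⇒≯ y<b)
... | inj₂ (_ , cbx) | inj₂ (_ , cby) rewrite cbx | cby = s≤s x<y

cb-injective : ∀ b {x y} → cb b x ≡ cb b y → x ≡ y
cb-injective b {x} {y} cbx≡cby with <-cmp x y
... | tri< x<y _ _ = contradiction cbx≡cby (<⇒≢ (cb-mono-< b x<y))
... | tri≈ _ x≡y _ = x≡y
... | tri> _ _ y<x = contradiction cbx≡cby (≢-sym (<⇒≢ (cb-mono-< b y<x)))

cb-≢ : ∀ b x → cb b x ≢ b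
cb-≢ b x with cb-cases b x
... | inj₁ (x<b , cbx) = λ cbx≡b → <⇒≢ x<b (trans (sym cbx) cbx≡b)
... | inj₂ (b≤x , cbx) = λ cbx≡b → <⇒≢ (s≤s b≤x) (sym (trans (sym cbx) cbx≡b))

cb-suc : ∀ K z → cb (suc K) (suc z) ≡ suc (cb K z)
cb-suc K z with z <ᵇ K
... | true = refl
... | false = refl

rank-map-cb : ∀ b s → rank (map (cb b) s) b ≡ rank s b
rank-map-cb b [] = refl
rank-map-cb b (z ∷ s) with cb-cases b z
... | inj₁ (z<b , cbz) rewrite rank-∷-< (map (cb b) s) (subst (_< b) (sym cbz) z<b) | rank-∷-< s z<b
  = cong suc (rank-map-cb b s)
... | inj₂ (b≤z , cbz) rewrite rank-∷-≮ (map (cb b) s) (subst (λ c → ¬ c < b) (sym cbz) (≤⇒≯ (m≤n⇒m≤1+n b≤z)))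
                            | rank-∷-≮ s (≤⇒≯ b≤z)
  = rank-map-cb b s

red-∷ : ∀ x t → x ∉ t → red (x ∷ t) ≡ suc (rank t x) ∷ map (cb (suc (rank t x))) (red t)
red-∷ x t x∉t = cong₂ _∷_ (cong suc (rank-∷-≮ t (<-irrefl refl))) (begin
  map (suc ∘ rank (x ∷ t)) t      ≡⟨ map-cong-local (tabulate shifted) ⟩
  map (cb K ∘ suc ∘ rank t) t     ≡⟨ map-∘ t ⟩
  map (cb K) (red t)              ∎)
  where
  open ≡-Reasoning
  K = suc (rank t x)
  shifted : ∀ {y} → y ∈ t → suc (rank (x ∷ t) y) ≡ cb K (suc (rank t y))
  shifted {y} y∈t with <-cmp x y
  ... | tri< x<y _ _ rewrite rank-∷-< t x<y = sym (cb-≥ (s≤s (rank-mono-≤ t (<⇒≤ x<y))))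
  ... | tri≈ _ refl _ = contradiction y∈t x∉t
  ... | tri> _ _ y<x rewrite rank-∷-≮ t (<⇒≯ y<x) = sym (cb-< (s≤s (rank-mono-< t y∈t y<x)))

-- Permutations of {1,…,m}

iota1-suc : ∀ m → iota1 (suc m) ≡ 1 ∷ map suc (iota1 m)
iota1-suc m = cong (λ w → 1 ∷ map suc w) (sym (map-upTo suc m))

iota1-∷ʳ : ∀ m → iota1 (suc m) ≡ iota1 m ∷ʳ suc m
iota1-∷ʳ m = trans (cong (map suc) (sym (upTo-∷ʳ m))) (map-++ suc (upTo m) (m ∷ []))

∈-iota1⁻ : ∀ {m y} → y ∈ iota1 m → ∃ λ k → k < m × y ≡ suc k
∈-iota1⁻ y∈iota1 with ∈-map⁻ suc y∈iota1
... | k , k∈upTo , y≡k+1 = k , ∈-upTo⁻ k∈upTo , y≡k+1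

∈-iota1⁺ : ∀ {m k} → k < m → suc k ∈ iota1 m
∈-iota1⁺ = ∈-map⁺ suc ∘ ∈-upTo⁺

length-iota1 : ∀ m → length (iota1 m) ≡ m
length-iota1 m = trans (length-map suc (upTo m)) (length-upTo m)

iota1-unique : ∀ m → Unique (iota1 m)
iota1-unique m = Unique.map⁺ suc-injective (Unique.upTo⁺ m)

take-iota1 : ∀ m → take m (iota1 (suc m)) ≡ iota1 m
take-iota1 m = begin
  take m (iota1 (suc m))      ≡⟨ cong (take m) (iota1-∷ʳ m) ⟩
  take m (iota1 m ∷ʳ suc m)   ≡⟨ take-∷ʳ (iota1 m) (suc m) (≤-reflexive (sym (length-iota1 m))) ⟩
  take m (iota1 m)            ≡⟨ take-all m (iota1 m) (≤-reflexive (length-iota1 m)) ⟩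
  iota1 m                     ∎
  where open ≡-Reasoning

rank-zero : ∀ t → rank t 0 ≡ 0
rank-zero [] = refl
rank-zero (_ ∷ t) = rank-zero t

rank-map-suc : ∀ t y → rank (map suc t) (suc y) ≡ rank t y
rank-map-suc [] y = refl
rank-map-suc (z ∷ t) y with z <ᵇ y
... | true = cong suc (rank-map-suc t y)
... | false = rank-map-suc t y

rank-upTo : ∀ {k m} → k ≤ m → rank (upTo m) k ≡ k
rank-upTo {zero} {m} _ = rank-zero (upTo m)
rank-upTo {suc k} {suc m} (s≤s k≤m) = cong suc (begin
  rank (applyUpTo suc m) (suc k)  ≡⟨ cong (λ w → rank w (suc k)) (map-upTo suc m) ⟨
  rank (map suc (upTo m)) (suc k) ≡⟨ rank-map-suc (upTo m) k ⟩
  rank (upTo m) k                 ≡⟨ rank-upTo k≤m ⟩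
  k                               ∎)
  where open ≡-Reasoning

rank-iota1 : ∀ {k m} → k ≤ m → rank (iota1 m) (suc k) ≡ k
rank-iota1 {k} {m} k≤m = trans (rank-map-suc (upTo m) k) (rank-upTo k≤m)

red-fixes-permutation : ∀ {m τ} → IsPermOf m τ → red τ ≡ τ
red-fixes-permutation {m} {τ} τ↭iota1 = trans (map-cong-local (tabulate fixes)) (map-id τ)
  where
  fixes : ∀ {y} → y ∈ τ → suc (rank τ y) ≡ y
  fixes y∈τ with ∈-iota1⁻ (Any-resp-↭ τ↭iota1 y∈τ)
  ... | k , k<m , refl = cong suc (trans (rank-↭ τ↭iota1 (suc k)) (rank-iota1 (<⇒≤ k<m)))

-- the permutation K, 1, …, K-1, K+1, …, m+1 of {1,…,m+1}
increasingAfter : ℕ → ℕ → Word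
increasingAfter K m = K ∷ map (cb K) (iota1 m)

increasingAfter-1 : ∀ m → increasingAfter 1 m ≡ iota1 (suc m)
increasingAfter-1 m = trans (cong (1 ∷_) (map-cong-local (tabulate ≥1))) (sym (iota1-suc m))
  where
  ≥1 : ∀ {y} → y ∈ iota1 m → cb 1 y ≡ suc y
  ≥1 y∈iota1 with ∈-iota1⁻ y∈iota1
  ... | _ , _ , refl = cb-≥ (s≤s z≤n)

increasingAfter-↭ : ∀ {K m} → 1 ≤ K → K ≤ suc m → increasingAfter K m ↭ iota1 (suc m)
increasingAfter-↭ {1} {m} _ _ = ↭-reflexive (increasingAfter-1 m)
increasingAfter-↭ {suc (suc k)} {suc m} _ (s≤s K≤m+1) = begin
  K ∷ map (cb K) (iota1 (suc m))                ≡⟨ cong (λ w → K ∷ map (cb K) w) (iota1-suc m) ⟩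
  K ∷ 1 ∷ map (cb K) (map suc (iota1 m))        ≡⟨ cong (λ w → K ∷ 1 ∷ w) shift ⟩
  K ∷ 1 ∷ map suc (map (cb (suc k)) (iota1 m))  ↭⟨ swap K 1 ↭-refl ⟩
  1 ∷ map suc (increasingAfter (suc k) m)       ↭⟨ prep 1 (↭.map⁺ suc (increasingAfter-↭ (s≤s z≤n) K≤m+1)) ⟩
  1 ∷ map suc (iota1 (suc m))                   ≡⟨ iota1-suc (suc m) ⟨
  iota1 (suc (suc m))                           ∎
  where
  open PermutationReasoning
  K = suc (suc k)
  shift : map (cb K) (map suc (iota1 m)) ≡ map suc (map (cb (suc k)) (iota1 m))
  shift = trans (sym (map-∘ (iota1 m))) (trans (map-cong-local (tabulate λ {z} _ → cb-suc (suc k) z)) (map-∘ (iota1 m)))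

red-↭-iota1 : ∀ {f} → Unique f → IsPermOf (length f) (red f)
red-↭-iota1 {[]} [] = ↭-refl
red-↭-iota1 {x ∷ t} xt-unique@(_ ∷ t-unique) = begin
  red (x ∷ t)                                ≡⟨ red-∷ x t (Unique.Unique[x∷xs]⇒x∉xs xt-unique) ⟩
  K ∷ map (cb K) (red t)                     ↭⟨ prep K (↭.map⁺ (cb K) (red-↭-iota1 t-unique)) ⟩
  increasingAfter K (length t)               ↭⟨ increasingAfter-↭ (s≤s z≤n) (s≤s (rank-≤-length t x)) ⟩
  iota1 (suc (length t))                     ∎
  where
  open PermutationReasoning
  K = suc (rank t x)

-- Factors and patterns

factors-≤ : ∀ {n x xs} → n ≤ length (x ∷ xs) → factors n (x ∷ xs) ≡ take n (x ∷ xs) ∷ factors n xs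
factors-≤ {n} {x} {xs} n≤ with n ≤? length (x ∷ xs)
... | yes _ = refl
... | no n≰ = contradiction n≤ n≰

factors-> : ∀ {n} xs → length xs < n → factors n xs ≡ []
factors-> [] _ = refl
factors-> {n} (x ∷ xs) len<n with n ≤? length (x ∷ xs)
... | yes n≤ = contradiction n≤ (<⇒≱ len<n)
... | no _ = refl

length-factors : ∀ m (w : Word) → length (factors (suc m) w) ≡ length w ∸ m
length-factors m [] = sym (0∸n≡0 m)
length-factors m (x ∷ xs) with suc m ≤? length (x ∷ xs)
... | yes (s≤s m≤) = trans (cong suc (length-factors m xs)) (sym (+-∸-assoc 1 m≤))
... | no m≰ = sym (m≤n⇒m∸n≡0 (≮⇒≥ m≰))

factors-length : ∀ n (w : Word) → All (λ u → length u ≡ n) (factors n w)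
factors-length n [] = []
factors-length n (x ∷ xs) with n ≤? length (x ∷ xs)
... | yes n≤ = trans (length-take n (x ∷ xs)) (m≤n⇒m⊓n≡m n≤) ∷ factors-length n xs
... | no _ = []

factors-unique : ∀ n {w : Word} → Unique w → All Unique (factors n w)
factors-unique n {[]} _ = []
factors-unique n {x ∷ xs} w-unique@(_ ∷ xs-unique) with n ≤? length (x ∷ xs)
... | yes _ = Unique.take⁺ n w-unique ∷ factors-unique n xs-unique
... | no _ = []

factors-map : ∀ n g (w : Word) → factors n (map g w) ≡ map (map g) (factors n w)
factors-map n g [] = refl
factors-map n g (x ∷ xs) with n ≤? length (x ∷ xs)
... | yes n≤ = trans (factors-≤ (subst (n ≤_) (sym (cong suc (length-map g xs))) n≤))
                     (cong₂ _∷_ (take-map n (x ∷ xs)) (factors-map n g xs))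
... | no n≰ = factors-> (map g (x ∷ xs)) (subst (_< n) (sym (cong suc (length-map g xs))) (≰⇒> n≰))

factors-∷ʳ : ∀ {m} (xs : Word) b → m ≤ length xs →
             factors (suc m) (xs ∷ʳ b) ≡ factors (suc m) xs ∷ʳ (drop (length xs ∸ m) xs ∷ʳ b)
factors-∷ʳ {zero} [] b _ = refl
factors-∷ʳ {m} (x ∷ xs) b m≤ with m≤n⇒m<n∨m≡n m≤
... | inj₁ (s≤s m≤len) = begin
  factors (suc m) (x ∷ xs ∷ʳ b)
    ≡⟨ factors-≤ (s≤s (subst (m ≤_) (sym (length-∷ʳ xs b)) (m≤n⇒m≤1+n m≤len))) ⟩
  (x ∷ take m (xs ∷ʳ b)) ∷ factors (suc m) (xs ∷ʳ b)
    ≡⟨ cong₂ (λ u us → (x ∷ u) ∷ us) (take-∷ʳ xs b m≤len) (factors-∷ʳ xs b m≤len) ⟩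
  take (suc m) (x ∷ xs) ∷ (factors (suc m) xs ∷ʳ (drop (length xs ∸ m) xs ∷ʳ b))
    ≡⟨ cong₂ (λ us k → us ∷ʳ (drop k (x ∷ xs) ∷ʳ b)) (sym (factors-≤ (s≤s m≤len))) (sym (+-∸-assoc 1 m≤len)) ⟩
  factors (suc m) (x ∷ xs) ∷ʳ (drop (length (x ∷ xs) ∸ m) (x ∷ xs) ∷ʳ b) ∎
  where open ≡-Reasoning
... | inj₂ refl = begin
  factors (suc m) (x ∷ xs ∷ʳ b)
    ≡⟨ factors-≤ (s≤s (≤-reflexive (sym (length-∷ʳ xs b)))) ⟩
  take (suc m) (x ∷ xs ∷ʳ b) ∷ factors (suc m) (xs ∷ʳ b)
    ≡⟨ cong₂ _∷_ (take-all (suc m) (x ∷ xs ∷ʳ b) (s≤s (≤-reflexive (length-∷ʳ xs b))))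
                 (factors-> (xs ∷ʳ b) (s≤s (≤-reflexive (length-∷ʳ xs b)))) ⟩
  (x ∷ xs ∷ʳ b) ∷ []
    ≡⟨ cong₂ (λ us k → us ∷ʳ (drop k (x ∷ xs) ∷ʳ b)) (sym (factors-> (x ∷ xs) ≤-refl)) (sym (n∸n≡0 m)) ⟩
  factors (suc m) (x ∷ xs) ∷ʳ (drop (length (x ∷ xs) ∸ m) (x ∷ xs) ∷ʳ b) ∎
  where open ≡-Reasoning

lastPart-∷ʳ : ∀ {m} (xs : Word) b → m ≤ length xs →
              lastPart (suc m) (xs ∷ʳ b) ≡ drop 1 (lastPart (suc m) xs ∷ʳ b)
lastPart-∷ʳ {m} xs b m≤ = begin
  drop (length (xs ∷ʳ b) ∸ m) (xs ∷ʳ b) ≡⟨ cong (λ l → drop (l ∸ m) (xs ∷ʳ b)) (length-∷ʳ xs b) ⟩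
  drop (suc (length xs) ∸ m) (xs ∷ʳ b)  ≡⟨ cong (λ k → drop k (xs ∷ʳ b)) (+-∸-assoc 1 m≤) ⟩
  drop (suc (length xs ∸ m)) (xs ∷ʳ b)  ≡⟨ drop-suc-∷ʳ xs b (m∸n≤m (length xs) m) ⟩
  drop 1 (drop (length xs ∸ m) xs ∷ʳ b) ∎
  where open ≡-Reasoning

lastPart-map : ∀ n g (w : Word) → lastPart n (map g w) ≡ map g (lastPart n w)
lastPart-map n g w = trans (cong (λ l → drop (l ∸ (n ∸ 1)) (map g w)) (length-map g w)) (drop-map (length w ∸ (n ∸ 1)) w)

length-lastPart : ∀ {m} (w : Word) → m ≤ length w → length (lastPart (suc m) w) ≡ m
length-lastPart {m} w m≤ = trans (length-drop (length w ∸ m) w) (m∸[m∸n]≡n m≤)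

patterns-map-∷ʳ : ∀ {m g} (w : Word) b → g Preserves _<_ ⟶ _<_ → m ≤ length w →
  patterns (suc m) (map g w ∷ʳ b) ≡ patterns (suc m) w ∷ʳ red (map g (lastPart (suc m) w) ∷ʳ b)
patterns-map-∷ʳ {m} {g} w b g-mono m≤ = begin
  map red (factors (suc m) (map g w ∷ʳ b))
    ≡⟨ cong (map red) (factors-∷ʳ (map g w) b (subst (m ≤_) (sym (length-map g w)) m≤)) ⟩
  map red (factors (suc m) (map g w) ∷ʳ (lastPart (suc m) (map g w) ∷ʳ b))
    ≡⟨ map-++ red (factors (suc m) (map g w)) _ ⟩
  map red (factors (suc m) (map g w)) ∷ʳ red (lastPart (suc m) (map g w) ∷ʳ b)
    ≡⟨ cong₂ (λ ps u → ps ∷ʳ red (u ∷ʳ b)) reduced-factors (lastPart-map (suc m) g w) ⟩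
  patterns (suc m) w ∷ʳ red (map g (lastPart (suc m) w) ∷ʳ b) ∎
  where
  open ≡-Reasoning
  reduced-factors : map red (factors (suc m) (map g w)) ≡ patterns (suc m) w
  reduced-factors = begin
    map red (factors (suc m) (map g w))         ≡⟨ cong (map red) (factors-map (suc m) g w) ⟩
    map red (map (map g) (factors (suc m) w))   ≡⟨ map-∘ (factors (suc m) w) ⟨
    map (λ u → red (map g u)) (factors (suc m) w)
      ≡⟨ map-cong (λ u → red-map-monotone (monotone⇒monotoneOn u g-mono)) (factors (suc m) w) ⟩
    patterns (suc m) w                          ∎

patterns-permutations : ∀ n {w : Word} → Unique w → All (IsPermOf n) (patterns n w)
patterns-permutations n {w} w-unique = All.map⁺ (All.zipWith perm (factors-length n w , factors-unique n w-unique))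
  where
  perm : ∀ {u} → length u ≡ n × Unique u → IsPermOf n (red u)
  perm (refl , u-unique) = red-↭-iota1 u-unique

length-initPart : ∀ m (w : Word) → length (initPart (suc m) w) ≡ length (patterns (suc m) w)
length-initPart m w = begin
  length (take (length w ∸ m) w)  ≡⟨ length-take (length w ∸ m) w ⟩
  (length w ∸ m) ⊓ length w       ≡⟨ m≤n⇒m⊓n≡m (m∸n≤m (length w) m) ⟩
  length w ∸ m                    ≡⟨ length-factors m w ⟨
  length (factors (suc m) w)      ≡⟨ length-map red (factors (suc m) w) ⟨
  length (patterns (suc m) w)     ∎
  where open ≡-Reasoning

-- Extensions of an increasing window

rank-ithSmallest : ∀ {s j} → suc j ∈ red s → rank s (ithSmallest s (suc j)) ≡ j
rank-ithSmallest {s} {j} j+1∈red-s with ∈-map⁻ (suc ∘ rank s) j+1∈red-s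
... | x , x∈s , j+1≡ = proj₂ (∈-filter⁻ ranked? {xs = s} (headOr-∈ {0} {xs = filter ranked? s} x∈filter))
  where
  ranked? : Decidable (λ y → rank s y ≡ j)
  ranked? y = rank s y ≟ j
  x∈filter : x ∈ filter ranked? s
  x∈filter = ∈-filter⁺ ranked? x∈s (sym (suc-injective j+1≡))

extB-≤ : ∀ {s i} → i ≤ length s → extB s i ≡ ithSmallest s i
extB-≤ {s} {i} i≤ with i ≤? length s
... | yes _ = refl
... | no i≰ = contradiction i≤ i≰

red-ext-∷ʳ : ∀ s i → ∃ λ u → red (ext s i) ≡ u ∷ʳ suc (rank s (extB s i))
red-ext-∷ʳ s i = u , trans (map-++ (suc ∘ rank e) (map (cb b) s) (b ∷ [])) (cong (λ r → u ∷ʳ suc r) rank-b)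
  where
  b = extB s i
  e = ext s i
  u = map (suc ∘ rank e) (map (cb b) s)
  rank-b : rank e b ≡ rank s b
  rank-b = begin
    rank (map (cb b) s ∷ʳ b) b               ≡⟨ rank-++ (map (cb b) s) (b ∷ []) b ⟩
    rank (map (cb b) s) b + rank (b ∷ []) b  ≡⟨ cong₂ _+_ (rank-map-cb b s) (rank-∷-≮ {b} {b} [] (<-irrefl refl)) ⟩
    rank s b + 0                             ≡⟨ +-identityʳ _ ⟩
    rank s b                                 ∎
    where open ≡-Reasoning

red-take-red-ext : ∀ {m} s i → length s ≡ m → red (take m (red (ext s i))) ≡ red s
red-take-red-ext {m} s i refl = begin
  red (take m (red (ext s i)))   ≡⟨ red-take-red m (ext s i) ⟩
  red (take m (map (cb b) s ∷ʳ b)) ≡⟨ cong red (take-∷ʳ (map (cb b) s) b (≤-reflexive (sym (length-map (cb b) s)))) ⟩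
  red (take m (map (cb b) s))    ≡⟨ cong red (take-all m (map (cb b) s) (≤-reflexive (length-map (cb b) s))) ⟩
  red (map (cb b) s)             ≡⟨ red-map-monotone (monotone⇒monotoneOn s (cb-mono-< b)) ⟩
  red s                          ∎
  where
  open ≡-Reasoning
  b = extB s i

Increasing : ℕ → Word → Set
Increasing m w = red w ≡ iota1 m

increasing? : ∀ m → Decidable (Increasing m)
increasing? m w = red w ≟w iota1 m

startsIncreasing? : ∀ m → Decidable (Increasing m ∘ take m)
startsIncreasing? m = increasing? m ∘ take m

endsIncreasing? : ∀ m → Decidable (Increasing m ∘ drop 1)
endsIncreasing? m = increasing? m ∘ drop 1

red-ext-increasing : ∀ {m s k} → Increasing m s → length s ≡ m → k < m →
                     ∃ λ u → red (ext s (suc k)) ≡ u ∷ʳ suc k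
red-ext-increasing {m} {s} {k} s-increasing refl k<m with red-ext-∷ʳ s (suc k)
... | u , red-ext≡ = u , trans red-ext≡ (cong (λ r → u ∷ʳ suc r) (begin
  rank s (extB s (suc k))        ≡⟨ cong (rank s) (extB-≤ {s} k<m) ⟩
  rank s (ithSmallest s (suc k)) ≡⟨ rank-ithSmallest (subst (suc k ∈_) (sym s-increasing) (∈-iota1⁺ k<m)) ⟩
  k                              ∎))
  where open ≡-Reasoning

extension-≡-iota1 : ∀ {m s i} → length s ≡ m → 1 ≤ i → i ≤ suc m → red (ext s i) ≡ iota1 (suc m) →
                    Increasing m s × i ≡ suc m
extension-≡-iota1 {m} {s} {suc k} length-s _ (s≤s k≤m) red-ext≡iota1 = s-increasing , cong suc k≡m
  where
  open ≡-Reasoning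
  s-increasing : Increasing m s
  s-increasing = begin
    red s                            ≡⟨ red-take-red-ext s (suc k) length-s ⟨
    red (take m (red (ext s (suc k)))) ≡⟨ cong (red ∘ take m) red-ext≡iota1 ⟩
    red (take m (iota1 (suc m)))     ≡⟨ cong red (take-iota1 m) ⟩
    red (iota1 m)                    ≡⟨ red-fixes-permutation ↭-refl ⟩
    iota1 m                          ∎
  k≡m : k ≡ m
  k≡m with m≤n⇒m<n∨m≡n k≤m
  ... | inj₂ k≡m = k≡m
  ... | inj₁ k<m with red-ext-increasing s-increasing length-s k<m
  ...   | u , red-ext≡ =
    suc-injective (∷ʳ-injectiveʳ u (iota1 m) (trans (sym red-ext≡) (trans red-ext≡iota1 (iota1-∷ʳ m))))

extensions-start-increasing : ∀ {m s} (P : List Word) → Increasing m s → length s ≡ m →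
  (∀ {k} → k < m → red (ext s (suc k)) ∈ P) → m ≤ count (startsIncreasing? m) P
extensions-start-increasing {m} {s} P s-increasing length-s extensions∈P = begin
  m                 ≡⟨ trans (length-map _ (iota1 m)) (length-iota1 m) ⟨
  length extensions ≤⟨ unique-⊆⇒length≤ extensions-unique extensions⊆ ⟩
  count (startsIncreasing? m) P ∎
  where
  open ≤-Reasoning
  extensions : List Word
  extensions = map (red ∘ ext s) (iota1 m)
  last-letter : ∀ {j} → j ∈ iota1 m → ∃ λ u → red (ext s j) ≡ u ∷ʳ j
  last-letter j∈iota1 with ∈-iota1⁻ j∈iota1
  ... | k , k<m , refl = red-ext-increasing s-increasing length-s k<m
  extensions-unique : Unique extensions
  extensions-unique = map-injectiveOn-unique (iota1-unique m) λ i∈ j∈ red-ext-i≡j →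
    let u , red-ext-i≡ = last-letter i∈
        v , red-ext-j≡ = last-letter j∈
    in ∷ʳ-injectiveʳ u v (trans (sym red-ext-i≡) (trans red-ext-i≡j red-ext-j≡))
  extensions⊆ : extensions ⊆ filter (startsIncreasing? m) P
  extensions⊆ z∈extensions with ∈-map⁻ (red ∘ ext s) z∈extensions
  ... | j , j∈iota1 , refl with ∈-iota1⁻ j∈iota1
  ...   | k , k<m , refl = ∈-filter⁺ (startsIncreasing? m) (extensions∈P k<m)
                             (trans (red-take-red-ext s (suc k) length-s) s-increasing)

ends-increasing-permutation : ∀ {m p} → IsPermOf (suc m) p → Increasing m (drop 1 p) →
                              ∃ λ k → k ≤ m × p ≡ increasingAfter (suc k) m
ends-increasing-permutation {m} {[]} []↭iota1 _ = contradiction (↭-length []↭iota1) 0≢1+n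
ends-increasing-permutation {m} {x ∷ t} p↭iota1 t-increasing = rank t x , rank≤m , (begin
  x ∷ t                  ≡⟨ red-fixes-permutation p↭iota1 ⟨
  red (x ∷ t)            ≡⟨ red-∷ x t x∉t ⟩
  K ∷ map (cb K) (red t) ≡⟨ cong (λ w → K ∷ map (cb K) w) t-increasing ⟩
  increasingAfter K m    ∎)
  where
  open ≡-Reasoning
  K = suc (rank t x)
  x∉t : x ∉ t
  x∉t = Unique.Unique[x∷xs]⇒x∉xs (Unique-resp-↭ (↭⇒↭ₛ (↭-sym p↭iota1)) (iota1-unique (suc m)))
  rank≤m : rank t x ≤ m
  rank≤m = subst (rank t x ≤_) (suc-injective (trans (↭-length p↭iota1) (length-iota1 (suc m)))) (rank-≤-length t x)

ends-increasing-bound : ∀ {m} (P : List Word) → Unique P → iota1 (suc m) ∉ P → All (IsPermOf (suc m)) P →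
                        count (endsIncreasing? m) P ≤ m
ends-increasing-bound {m} P P-unique iota1∉P P-permutations = begin
  count (endsIncreasing? m) P ≤⟨ unique-⊆⇒length≤ (Unique.filter⁺ (endsIncreasing? m) P-unique) ends⊆ ⟩
  length candidates           ≡⟨ trans (length-map _ (upTo m)) (length-upTo m) ⟩
  m                           ∎
  where
  open ≤-Reasoning
  candidates : List Word
  candidates = map (λ k → increasingAfter (suc (suc k)) m) (upTo m)
  ends⊆ : filter (endsIncreasing? m) P ⊆ candidates
  ends⊆ p∈filter with ∈-filter⁻ (endsIncreasing? m) p∈filter
  ... | p∈P , ends-increasing with ends-increasing-permutation (All.lookup P-permutations p∈P) ends-increasing
  ...   | zero , _ , refl = contradiction (subst (_∈ P) (increasingAfter-1 m) p∈P) iota1∉P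
  ...   | suc k , k<m , refl = ∈-map⁺ (λ k → increasingAfter (suc (suc k)) m) (∈-upTo⁺ k<m)

-- The greedy invariant

Balanced : ℕ → List Word → Word → Set
Balanced m P s = count (endsIncreasing? m) P ≡ count (startsIncreasing? m) P + count (increasing? m) (s ∷ [])

balanced-∷ʳ : ∀ {m} P s i → length s ≡ m → Balanced m P s →
              Balanced m (P ∷ʳ red (ext s i)) (drop 1 (ext s i))
balanced-∷ʳ {m} P s i length-s balanced = begin
  ends (P ∷ʳ q)                       ≡⟨ count-∷ʳ (endsIncreasing? m) P q ⟩
  ends P + ends (q ∷ [])              ≡⟨ cong₂ _+_ balanced ends-q ⟩
  starts P + increasing (s ∷ []) + increasing (s' ∷ [])
                                      ≡⟨ cong (λ c → starts P + c + increasing (s' ∷ [])) starts-q ⟨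
  starts P + starts (q ∷ []) + increasing (s' ∷ [])
                                      ≡⟨ cong (_+ increasing (s' ∷ [])) (count-∷ʳ (startsIncreasing? m) P q) ⟨
  starts (P ∷ʳ q) + increasing (s' ∷ []) ∎
  where
  open ≡-Reasoning
  ends = count (endsIncreasing? m)
  starts = count (startsIncreasing? m)
  increasing = count (increasing? m)
  q = red (ext s i)
  s' = drop 1 (ext s i)
  ends-q : ends (q ∷ []) ≡ increasing (s' ∷ [])
  ends-q = count-[-]-cong (endsIncreasing? m) (increasing? m) {q} {s'}
             (trans (sym (red-drop-red 1 (ext s i)))) (trans (red-drop-red 1 (ext s i)))
  starts-q : starts (q ∷ []) ≡ increasing (s ∷ [])
  starts-q = count-[-]-cong (startsIncreasing? m) (increasing? m) {q} {s}
               (trans (sym (red-take-red-ext s i length-s))) (trans (red-take-red-ext s i length-s))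

record GreedyInvariant (m : ℕ) (W : Word) : Set where
  field
    distinct : Unique W
    long : m ≤ length W
    patterns-distinct : Unique (patterns (suc m) W)
    iota1-absent : iota1 (suc m) ∉ patterns (suc m) W
    balanced : Balanced m (patterns (suc m) W) (lastPart (suc m) W)

greedy-avoids-iota1 : ∀ {m W i} → GreedyInvariant m W → 1 ≤ i → i ≤ suc m →
  (∀ {j} → 1 ≤ j → j < i → red (ext (lastPart (suc m) W) j) ∈ patterns (suc m) W) →
  red (ext (lastPart (suc m) W) i) ≢ iota1 (suc m)
greedy-avoids-iota1 {m} {W} inv 1≤i i≤m+1 earlier∈P red-ext≡iota1
  with extension-≡-iota1 (length-lastPart W (GreedyInvariant.long inv)) 1≤i i≤m+1 red-ext≡iota1
... | s-increasing , refl = <-irrefl refl (begin-strict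
  m                                       ≤⟨ extensions-start-increasing P s-increasing (length-lastPart W long)
                                               (λ k<m → earlier∈P (s≤s z≤n) (s≤s k<m)) ⟩
  count (startsIncreasing? m) P           <⟨ m<m+n _ (s≤s z≤n) ⟩
  count (startsIncreasing? m) P + 1       ≡⟨ cong (λ l → count (startsIncreasing? m) P + length l)
                                               (filter-accept (increasing? m) s-increasing) ⟨
  count (startsIncreasing? m) P + count (increasing? m) (s ∷ [])
                                          ≡⟨ balanced ⟨
  count (endsIncreasing? m) P             ≤⟨ ends-increasing-bound P patterns-distinct iota1-absent
                                               (patterns-permutations (suc m) distinct) ⟩
  m                                       ∎)
  where
  open GreedyInvariant inv
  open ≤-Reasoning
  P = patterns (suc m) W
  s = lastPart (suc m) W

cb-∷ʳ-unique : ∀ b {w} → Unique w → Unique (map (cb b) w ∷ʳ b)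
cb-∷ʳ-unique b w-unique = Unique.++⁺ (Unique.map⁺ (cb-injective b) w-unique) ([] ∷ []) b∉
  where
  b∉ : ∀ {v} → ¬ (v ∈ map (cb b) _ × v ∈ b ∷ [])
  b∉ (v∈ , here refl) with ∈-map⁻ (cb b) v∈
  ... | x , _ , v≡cbx = cb-≢ b x (sym v≡cbx)

greedy-step-preserves : ∀ {m W W'} → GreedyInvariant m W → GreedyStep (suc m) W W' → GreedyInvariant m W'
greedy-step-preserves {m} {W} inv (i , 1≤i , i≤m+1 , new , earlier-old , refl) = record
  { distinct = cb-∷ʳ-unique b distinct
  ; long = subst (m ≤_) (sym (trans (length-∷ʳ (map (cb b) W) b) (cong suc (length-map (cb b) W)))) (m≤n⇒m≤1+n long)
  ; patterns-distinct = subst Unique (sym patterns-W')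
                          (Unique.++⁺ patterns-distinct ([] ∷ []) λ { (q∈P , here refl) → new q∈P })
  ; iota1-absent = subst (iota1 (suc m) ∉_) (sym patterns-W') iota1∉
  ; balanced = subst₂ (Balanced m) (sym patterns-W') (sym lastPart-W')
                 (balanced-∷ʳ P s i (length-lastPart W long) balanced)
  }
  where
  open GreedyInvariant inv
  s = lastPart (suc m) W
  b = extB s i
  P = patterns (suc m) W
  patterns-W' : patterns (suc m) (map (cb b) W ∷ʳ b) ≡ P ∷ʳ red (ext s i)
  patterns-W' = patterns-map-∷ʳ W b (cb-mono-< b) long
  lastPart-W' : lastPart (suc m) (map (cb b) W ∷ʳ b) ≡ drop 1 (ext s i)
  lastPart-W' = trans (lastPart-∷ʳ (map (cb b) W) b (subst (m ≤_) (sym (length-map (cb b) W)) long))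
                      (cong (λ u → drop 1 (u ∷ʳ b)) (lastPart-map (suc m) (cb b) W))
  earlier∈P : ∀ {j} → 1 ≤ j → j < i → red (ext s j) ∈ P
  earlier∈P {j} 1≤j j<i = decidable-stable (red (ext s j) ∈? P) (earlier-old j 1≤j j<i)
  iota1∉ : iota1 (suc m) ∉ P ∷ʳ red (ext s i)
  iota1∉ iota1∈ with ∈-++⁻ P iota1∈
  ... | inj₁ iota1∈P = iota1-absent iota1∈P
  ... | inj₂ (here iota1≡) = greedy-avoids-iota1 inv 1≤i i≤m+1 earlier∈P (sym iota1≡)

greedy-run-preserves : ∀ {m W W'} → GreedyInvariant m W → Star (GreedyStep (suc m)) W W' → GreedyInvariant m W'
greedy-run-preserves inv ε = inv
greedy-run-preserves inv (step ◅ steps) = greedy-run-preserves (greedy-step-preserves inv step) steps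

greedy-start : ∀ {m τ} → IsPermOf m τ → τ ≢ iota1 m → GreedyInvariant m τ
greedy-start {m} {τ} τ↭iota1 τ≢iota1 = record
  { distinct = Unique-resp-↭ (↭⇒↭ₛ (↭-sym τ↭iota1)) (iota1-unique m)
  ; long = ≤-reflexive (sym length-τ)
  ; patterns-distinct = subst Unique (sym patterns-τ) []
  ; iota1-absent = subst (iota1 (suc m) ∉_) (sym patterns-τ) λ ()
  ; balanced = subst₂ (Balanced m) (sym patterns-τ) (sym lastPart-τ)
                 (sym (cong length (filter-reject (increasing? m) τ-not-increasing)))
  }
  where
  length-τ : length τ ≡ m
  length-τ = trans (↭-length τ↭iota1) (length-iota1 m)
  patterns-τ : patterns (suc m) τ ≡ []
  patterns-τ = cong (map red) (factors-> τ (s≤s (≤-reflexive length-τ)))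
  lastPart-τ : lastPart (suc m) τ ≡ τ
  lastPart-τ = trans (cong (λ l → drop (l ∸ m) τ) length-τ) (cong (λ k → drop k τ) (n∸n≡0 m))
  τ-not-increasing : ¬ Increasing m τ
  τ-not-increasing = τ≢iota1 ∘ trans (sym (red-fixes-permutation τ↭iota1))

-- Universal cycles

universal-cycle-length : ∀ {n} C {ps} → IsUCycle n C → Unique ps → All (IsPermOf n) ps → length ps ≤ length C
universal-cycle-length {n} C {ps} universal ps-unique ps-permutations = begin
  length ps                                    ≤⟨ unique-⊆⇒length≤ ps-unique ps⊆ ⟩
  length (map cyclicPattern (upTo (length C))) ≡⟨ length-map cyclicPattern (upTo (length C)) ⟩
  length (upTo (length C))                     ≡⟨ length-upTo (length C) ⟩
  length C                                     ∎
  where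
  open ≤-Reasoning
  cyclicPattern : ℕ → Word
  cyclicPattern j = red (cycFactor n C j)
  occurring : ∀ {p} → occurrences n C p ≡ 1 → p ∈ map cyclicPattern (upTo (length C))
  occurring {p} once with filter (λ j → cyclicPattern j ≟w p) (upTo (length C)) in positions
  ... | j ∷ _ with ∈-filter⁻ (λ j → cyclicPattern j ≟w p) (subst (j ∈_) (sym positions) (here refl))
  ...   | j∈upTo , refl = ∈-map⁺ cyclicPattern j∈upTo
  ps⊆ : ps ⊆ map cyclicPattern (upTo (length C))
  ps⊆ p∈ps = occurring (universal _ (All.lookup ps-permutations p∈ps))

theorem2p5 : (n : ℕ) → 2 ≤ n → (τ : Word) → IsPermOf (n ∸ 1) τ → ¬ (τ ≡ iota1 (n ∸ 1))
    → (W : Word) → GreedyOutput n τ W → ¬ IsUCycle n (red (initPart n W))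
theorem2p5 zero () _ _ _ _ _
theorem2p5 (suc m) _ τ τ↭iota1 τ≢iota1 W (run , _) universal = <-irrefl refl (begin-strict
  length P                               <⟨ n<1+n (length P) ⟩
  length (iota1 (suc m) ∷ P)             ≤⟨ universal-cycle-length C universal
                                              (All.¬Any⇒All¬ P iota1-absent ∷ patterns-distinct)
                                              (↭-refl ∷ patterns-permutations (suc m) distinct) ⟩
  length C                               ≡⟨ trans (length-map _ (initPart (suc m) W)) (length-initPart m W) ⟩
  length P                               ∎)
  where
  open GreedyInvariant (greedy-run-preserves (greedy-start τ↭iota1 τ≢iota1) run)
  open ≤-Reasoning
  P = patterns (suc m) W
  C = red (initPart (suc m) W)
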